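{- Let $\mathbf{L}\in\{\mathbf{K_n},\mathbf{KD_n},\mathbf{KT_n}\}$. The cut rule is admissible in $\mathsf{G}(\mathbf{L})$: for all finite multisets $\Gamma,\Gamma',\Delta,\Delta'$ and every formula $A$, if $\mathsf{G}(\mathbf{L})\vdash\Gamma\Rightarrow\Delta,A$ and $\mathsf{G}(\mathbf{L})\vdash A,\Gamma'\Rightarrow\Delta'$, then $\mathsf{G}(\mathbf{L})\vdash\Gamma,\Gamma'\Rightarrow\Delta,\Delta'$.
   Context: Formulas of $\mathcal{L}^1$ over a finite agent set and countable $\mathsf{Prop}$: $A::=p\mid\bot\mid A\wedge A\mid A\vee A\mid A\rightarrow A\mid\neg A\mid\Box_i A$. Outmost-boxed formula: $\Box_jB$; $\Box_i\Gamma=\{\Box_iA:A\in\Gamma\}$. Sequents are pairs of finite multisets. $\mathsf{G}(\mathbf{K_n})$: initial sequents $\Gamma,p\Rightarrow p,\Delta$ and $\bot,\Gamma\Rightarrow\Delta$; logical rules $(R\wedge)$: $\Gamma\Rightarrow\Delta,A_1$ and $\Gamma\Rightarrow\Delta,A_2$ / $\Gamma\Rightarrow\Delta,A_1\wedge A_2$; $(L\wedge)$: $A_1,A_2,\Gamma\Rightarrow\Delta$ / $A_1\wedge A_2,\Gamma\Rightarrow\Delta$; $(R\vee)$: $\Gamma\Rightarrow\Delta,A_1,A_2$ / $\Gamma\Rightarrow\Delta,A_1\vee A_2$; $(L\vee)$: $A_1,\Gamma\Rightarrow\Delta$ and $A_2,\Gamma\Rightarrow\Delta$ / $A_1\vee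 A_2,\Gamma\Rightarrow\Delta$; $(R\rightarrow)$: $A_1,\Gamma\Rightarrow\Delta,A_2$ / $\Gamma\Rightarrow\Delta,A_1\rightarrow A_2$; $(L\rightarrow)$: $\Gamma\Rightarrow\Delta,A_1$ and $A_2,\Gamma\Rightarrow\Delta$ / $A_1\rightarrow A_2,\Gamma\Rightarrow\Delta$; $(R\neg)$: $A,\Gamma\Rightarrow\Delta$ / $\Gamma\Rightarrow\Delta,\neg A$; $(L\neg)$: $\Gamma\Rightarrow\Delta,A$ / $\neg A,\Gamma\Rightarrow\Delta$; $(\Box_{Kn})$: from $\Gamma\Rightarrow A$ infer $\Sigma,\Box_i\Gamma\Rightarrow\Box_iA,\Omega$ (members of $\Sigma$: propositional variables, $\bot$, or $\Box_jB$ with $j\neq i$; members of $\Omega$: propositional variables, $\bot$, or outmost-boxed formulas). $\mathsf{G}(\mathbf{KD_n})$ adds $(\Box_{Dn})$: from $\Gamma\Rightarrow$ ($\Gamma\neq\emptyset$) infer $\Sigma,\Box_i\Gamma\Rightarrow\Omega$ ($\Sigma,\Omega$ as in $(\Box_{Kn})$). $\mathsf{G}(\mathbf{KT_n})$ adds $(\Box_{Tn})$: from $\Box_iA,A,\Gamma\Rightarrow\Delta$ infer $\Box_iA,\Gamma\Rightarrow\Delta$. -}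

module Defs where

open import Data.Nat using (ℕ)
open import Data.Fin using (Fin)
open import Data.List using (List; []; _∷_; _++_; map)
open import Data.List.Relation.Unary.All using (All)
open import Data.List.Relation.Binary.Permutation.Propositional using (_↭_)
open import Relation.Binary.PropositionalEquality using (_≡_)
open import Relation.Nullary using (¬_)

data Fm (n : ℕ) : Set where
  var  : ℕ → Fm n
  ⊥'   : Fm n
  _∧'_ : Fm n → Fm n → Fm n
  _∨'_ : Fm n → Fm n → Fm n
  _⇒'_ : Fm n → Fm n → Fm n
  ¬'_  : Fm n → Fm n
  □    : Fin n → Fm n → Fm n

□* : ∀ {n} → Fin n → List (Fm n) → List (Fm n)
□* i = map (□ i)

data OmegaOK {n : ℕ} : Fm n → Set where
  ω-var : ∀ p → OmegaOK (var p)
  ω-⊥   : OmegaOK ⊥'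
  ω-□   : ∀ j B → OmegaOK (□ j B)

data SigmaOK {n : ℕ} (i : Fin n) : Fm n → Set where
  σ-var : ∀ p → SigmaOK i (var p)
  σ-⊥   : SigmaOK i ⊥'
  σ-□   : ∀ j B → ¬ (j ≡ i) → SigmaOK i (□ j B)

data Logic : Set where
  Kn KDn KTn : Logic

-- Sequents are pairs of finite multisets: represented by lists, and every
-- rule's conclusion is taken up to permutation (_↭_) of both sides, so that
-- derivability depends only on the underlying multisets.
infix 4 _⊢_⇒_
data _⊢_⇒_ {n : ℕ} (L : Logic) : List (Fm n) → List (Fm n) → Set where
  init : ∀ {Γ Δ Γ₀ Δ₀} p → Γ₀ ↭ var p ∷ Γ → Δ₀ ↭ var p ∷ Δ → L ⊢ Γ₀ ⇒ Δ₀
  ⊥L   : ∀ {Γ Δ Γ₀} → Γ₀ ↭ ⊥' ∷ Γ → L ⊢ Γ₀ ⇒ Δ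
  ∧R   : ∀ {Γ Δ Δ₀ A₁ A₂} → Δ₀ ↭ (A₁ ∧' A₂) ∷ Δ →
         L ⊢ Γ ⇒ A₁ ∷ Δ → L ⊢ Γ ⇒ A₂ ∷ Δ → L ⊢ Γ ⇒ Δ₀
  ∧L   : ∀ {Γ Δ Γ₀ A₁ A₂} → Γ₀ ↭ (A₁ ∧' A₂) ∷ Γ →
         L ⊢ A₁ ∷ A₂ ∷ Γ ⇒ Δ → L ⊢ Γ₀ ⇒ Δ
  ∨R   : ∀ {Γ Δ Δ₀ A₁ A₂} → Δ₀ ↭ (A₁ ∨' A₂) ∷ Δ →
         L ⊢ Γ ⇒ A₁ ∷ A₂ ∷ Δ → L ⊢ Γ ⇒ Δ₀
  ∨L   : ∀ {Γ Δ Γ₀ A₁ A₂} → Γ₀ ↭ (A₁ ∨' A₂) ∷ Γ →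
         L ⊢ A₁ ∷ Γ ⇒ Δ → L ⊢ A₂ ∷ Γ ⇒ Δ → L ⊢ Γ₀ ⇒ Δ
  ⇒R   : ∀ {Γ Δ Δ₀ A₁ A₂} → Δ₀ ↭ (A₁ ⇒' A₂) ∷ Δ →
         L ⊢ A₁ ∷ Γ ⇒ A₂ ∷ Δ → L ⊢ Γ ⇒ Δ₀
  ⇒L   : ∀ {Γ Δ Γ₀ A₁ A₂} → Γ₀ ↭ (A₁ ⇒' A₂) ∷ Γ →
         L ⊢ Γ ⇒ A₁ ∷ Δ → L ⊢ A₂ ∷ Γ ⇒ Δ → L ⊢ Γ₀ ⇒ Δ
  ¬R   : ∀ {Γ Δ Δ₀ A} → Δ₀ ↭ (¬' A) ∷ Δ →
         L ⊢ A ∷ Γ ⇒ Δ → L ⊢ Γ ⇒ Δ₀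
  ¬L   : ∀ {Γ Δ Γ₀ A} → Γ₀ ↭ (¬' A) ∷ Γ →
         L ⊢ Γ ⇒ A ∷ Δ → L ⊢ Γ₀ ⇒ Δ
  □K   : ∀ {i Γ A Σ Ω Γ₀ Δ₀} → All (SigmaOK i) Σ → All OmegaOK Ω →
         Γ₀ ↭ Σ ++ □* i Γ → Δ₀ ↭ □ i A ∷ Ω →
         L ⊢ Γ ⇒ A ∷ [] → L ⊢ Γ₀ ⇒ Δ₀
  □D   : ∀ {i G Γ Σ Ω Γ₀ Δ₀} → L ≡ KDn → All (SigmaOK i) Σ → All OmegaOK Ω →
         Γ₀ ↭ Σ ++ □* i (G ∷ Γ) → Δ₀ ↭ Ω →
         L ⊢ G ∷ Γ ⇒ [] → L ⊢ Γ₀ ⇒ Δ₀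
  □T   : ∀ {i A Γ Δ Γ₀} → L ≡ KTn → Γ₀ ↭ □ i A ∷ Γ →
         L ⊢ □ i A ∷ A ∷ Γ ⇒ Δ → L ⊢ Γ₀ ⇒ Δ

{-# OPTIONS --safe #-}
module Submission where

-- Cut is proved in its context-sharing form (Γ ⇒ A, Δ and A, Γ ⇒ Δ give
-- Γ ⇒ Δ) by induction on A; the theorem then follows by weakening.
-- For a compound A every logical rule is invertible, so both premises are
-- inverted and the cut is replaced by cuts on the immediate subformulas.
-- For A a variable, ⊥ or a box, an induction on the left derivation moves
-- the cut up to the inferences where A is principal on the right: an
-- initial sequent p ⇒ p turns the cut into a contraction of p, and a □K
-- inference with premise Γ₁ ⇒ B and conclusion Σ, □ᵢΓ₁ ⇒ □ᵢB, Ω starts an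
-- induction on the right derivation that removes □ᵢB from its antecedent.
-- There □ᵢB is principal only in □K or □D, where it is one of the boxed
-- formulas and the premise is cut with Γ₁ ⇒ B, or in □T, where the new copy
-- of B is cut with Γ₁ ⇒ B after Γ₁ is unboxed from □ᵢΓ₁ by □T itself.

open import Defs
open import Data.Nat using (ℕ)
open import Data.Fin using (Fin)
open import Data.Fin.Properties using (_≟_)
open import Data.List using (List; []; _∷_; _++_; [_])
open import Data.List.Membership.Propositional using (_∈_; _∉_)
open import Data.List.Membership.Propositional.Properties using (∈-++⁻; ∈-map⁻; ∈-∃++)
open import Data.List.Relation.Unary.All as All using (All; []; _∷_; head; tail)
open import Data.List.Relation.Unary.Any using (here; there)
open import Data.List.Relation.Binary.Permutation.Propositional
  using (_↭_; ↭-refl; ↭-sym; ↭-trans; ↭-prep; ↭-swap)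
open import Data.List.Relation.Binary.Permutation.Propositional.Properties
  using (∈-resp-↭; All-resp-↭; drop-∷; shift; shifts; ++⁺ˡ; ++⁺ʳ; ++-comm; ++-assoc; map⁺)
open import Data.Product using (∃; _×_; _,_; proj₂)
open import Data.Sum using (_⊎_; inj₁; inj₂)
open import Data.Empty using (⊥-elim)
open import Relation.Nullary using (¬_; yes; no)
open import Relation.Binary.PropositionalEquality using (_≡_; _≢_; refl)

private variable
  S : Set
  a b x : S
  xs ys zs P Q : List S

∈-∃↭ : x ∈ xs → ∃ λ ys → xs ↭ x ∷ ys
∈-∃↭ x∈xs with ys , zs , refl ← ∈-∃++ x∈xs = ys ++ zs , shift _ ys zs

↭∷⇒∈ : xs ↭ x ∷ ys → x ∈ xs
↭∷⇒∈ p = ∈-resp-↭ (↭-sym p) (here refl)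

↭-sym-trans : xs ↭ ys → xs ↭ zs → ys ↭ zs
↭-sym-trans p q = ↭-trans (↭-sym p) q

↭-∷-inv : a ∷ xs ↭ b ∷ ys →
          (a ≡ b × xs ↭ ys) ⊎ (∃ λ zs → ys ↭ a ∷ zs × xs ↭ b ∷ zs)
↭-∷-inv p with ∈-resp-↭ p (here refl)
... | here refl  = inj₁ (refl , drop-∷ p)
... | there a∈ys =
  let zs , ys↭azs = ∈-∃↭ a∈ys
  in  inj₂ (zs , ys↭azs , drop-∷ (↭-trans p (↭-trans (↭-prep _ ys↭azs) (↭-swap _ _ ↭-refl))))

↭-∷-inv-≢ : a ∷ xs ↭ b ∷ ys → a ≢ b → ∃ λ zs → ys ↭ a ∷ zs × xs ↭ b ∷ zs
↭-∷-inv-≢ p a≢b with ↭-∷-inv p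
... | inj₁ (a≡b , _) = ⊥-elim (a≢b a≡b)
... | inj₂ r         = r

↭-∷-inv₂-≢ : a ∷ xs ↭ b ∷ b ∷ ys → a ≢ b →
             ∃ λ zs → ys ↭ a ∷ zs × xs ↭ b ∷ b ∷ zs
↭-∷-inv₂-≢ p a≢b =
  let zs , bys↭azs , xs↭bzs = ↭-∷-inv-≢ p a≢b
      ws , ys↭aws  , zs↭bws = ↭-∷-inv-≢ (↭-sym bys↭azs) a≢b
  in  ws , ys↭aws , ↭-trans xs↭bzs (↭-prep _ zs↭bws)

↭-dedup-∷ : xs ↭ x ∷ ys → xs ↭ a ∷ a ∷ zs → ∃ λ ws → a ∷ zs ↭ x ∷ ws
↭-dedup-∷ p q with ∈-resp-↭ q (↭∷⇒∈ p)
... | here refl   = _ , ↭-refl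
... | there x∈azs = ∈-∃↭ x∈azs

++⁺ˡ-shifts : ∀ Q P → xs ↭ P ++ ys → Q ++ xs ↭ P ++ Q ++ ys
++⁺ˡ-shifts Q P p = ↭-trans (++⁺ˡ Q p) (shifts Q P)

++⁺ˡ-shift : ∀ Q → xs ↭ x ∷ ys → Q ++ xs ↭ x ∷ Q ++ ys
++⁺ˡ-shift Q = ++⁺ˡ-shifts Q [ _ ]

drop-∷-∉ : a ∷ xs ↭ P ++ Q → a ∉ P → ∃ λ Q′ → xs ↭ P ++ Q′
drop-∷-∉ {P = P} p a∉P with ∈-++⁻ P (∈-resp-↭ p (here refl))
... | inj₁ a∈P = ⊥-elim (a∉P a∈P)
... | inj₂ a∈Q =
  let Q′ , Q↭aQ′ = ∈-∃↭ a∈Q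
  in  Q′ , drop-∷ (↭-trans p (++⁺ˡ-shift P Q↭aQ′))

module CutAdmissibility {n : ℕ} (L : Logic) where

  private variable
    p : ℕ
    i : Fin n
    A B C F : Fm n
    Γ Γ′ Γ₀ Γ₁ Δ Δ′ Δ₀ Π Π₀ Θ R Σ Ω : List (Fm n)

  data Compound : Fm n → Set where
    c∧ : Compound (A ∧' B)
    c∨ : Compound (A ∨' B)
    c⇒ : Compound (A ⇒' B)
    c¬ : Compound (¬' A)

  data RightPremise : Fm n → List (Fm n) → List (Fm n) → Set where
    r∧₁ : RightPremise (A ∧' B) [] [ A ]
    r∧₂ : RightPremise (A ∧' B) [] [ B ]
    r∨  : RightPremise (A ∨' B) [] (A ∷ B ∷ [])
    r⇒  : RightPremise (A ⇒' B) [ A ] [ B ]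
    r¬  : RightPremise (¬' A) [ A ] []

  data LeftPremise : Fm n → List (Fm n) → List (Fm n) → Set where
    l∧  : LeftPremise (A ∧' B) (A ∷ B ∷ []) []
    l∨₁ : LeftPremise (A ∨' B) [ A ] []
    l∨₂ : LeftPremise (A ∨' B) [ B ] []
    l⇒₁ : LeftPremise (A ⇒' B) [] [ A ]
    l⇒₂ : LeftPremise (A ⇒' B) [ B ] []
    l¬  : LeftPremise (¬' A) [] [ A ]

  -- Derivability in G(L), with the eight logical rules merged into logicalR
  -- and logicalL (a premise X, Γ ⇒ Y, Δ for each RightPremise/LeftPremise F X Y)
  -- and with both sides of every conclusion, including the logical ones, taken
  -- up to permutation, so that exchange needs no induction.
  infix 4 _⊩_
  data _⊩_ : List (Fm n) → List (Fm n) → Set where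
    init     : ∀ p → Γ₀ ↭ var p ∷ Γ → Δ₀ ↭ var p ∷ Δ → Γ₀ ⊩ Δ₀
    ⊥L       : Γ₀ ↭ ⊥' ∷ Γ → Γ₀ ⊩ Δ
    logicalR : Compound F → Γ₀ ↭ Γ → Δ₀ ↭ F ∷ Δ →
               (∀ {X Y} → RightPremise F X Y → X ++ Γ ⊩ Y ++ Δ) → Γ₀ ⊩ Δ₀
    logicalL : Compound F → Γ₀ ↭ F ∷ Γ → Δ₀ ↭ Δ →
               (∀ {X Y} → LeftPremise F X Y → X ++ Γ ⊩ Y ++ Δ) → Γ₀ ⊩ Δ₀
    □K       : All (SigmaOK i) Σ → All OmegaOK Ω →
               Γ₀ ↭ Σ ++ □* i Γ → Δ₀ ↭ □ i A ∷ Ω → Γ ⊩ [ A ] → Γ₀ ⊩ Δ₀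
    □D       : L ≡ KDn → All (SigmaOK i) Σ → All OmegaOK Ω →
               Γ₀ ↭ Σ ++ □* i (A ∷ Γ) → Δ₀ ↭ Ω → A ∷ Γ ⊩ [] → Γ₀ ⊩ Δ₀
    □T       : L ≡ KTn →
               Γ₀ ↭ □ i A ∷ Γ → Δ₀ ↭ Δ → □ i A ∷ A ∷ Γ ⊩ Δ → Γ₀ ⊩ Δ₀

  exchange : Γ ⊩ Δ → Γ ↭ Γ′ → Δ ↭ Δ′ → Γ′ ⊩ Δ′
  exchange (init p a b)       g h = init p (↭-sym-trans g a) (↭-sym-trans h b)
  exchange (⊥L a)             g h = ⊥L (↭-sym-trans g a)
  exchange (logicalR c a b f) g h = logicalR c (↭-sym-trans g a) (↭-sym-trans h b) f
  exchange (logicalL c a b f) g h = logicalL c (↭-sym-trans g a) (↭-sym-trans h b) f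
  exchange (□K σ ω a b d)     g h = □K σ ω (↭-sym-trans g a) (↭-sym-trans h b) d
  exchange (□D ≡KD σ ω a b d) g h = □D ≡KD σ ω (↭-sym-trans g a) (↭-sym-trans h b) d
  exchange (□T ≡KT a b d)     g h = □T ≡KT (↭-sym-trans g a) (↭-sym-trans h b) d

  ⊢⇒⊩ : L ⊢ Γ ⇒ Δ → Γ ⊩ Δ
  ⊢⇒⊩ (init p a b)       = init p a b
  ⊢⇒⊩ (⊥L a)             = ⊥L a
  ⊢⇒⊩ (∧R b d₁ d₂)       = logicalR c∧ ↭-refl b
                              λ { r∧₁ → ⊢⇒⊩ d₁ ; r∧₂ → ⊢⇒⊩ d₂ }
  ⊢⇒⊩ (∧L a d)           = logicalL c∧ a ↭-refl λ { l∧ → ⊢⇒⊩ d }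
  ⊢⇒⊩ (∨R b d)           = logicalR c∨ ↭-refl b λ { r∨ → ⊢⇒⊩ d }
  ⊢⇒⊩ (∨L a d₁ d₂)       = logicalL c∨ a ↭-refl
                              λ { l∨₁ → ⊢⇒⊩ d₁ ; l∨₂ → ⊢⇒⊩ d₂ }
  ⊢⇒⊩ (⇒R b d)           = logicalR c⇒ ↭-refl b λ { r⇒ → ⊢⇒⊩ d }
  ⊢⇒⊩ (⇒L a d₁ d₂)       = logicalL c⇒ a ↭-refl
                              λ { l⇒₁ → ⊢⇒⊩ d₁ ; l⇒₂ → ⊢⇒⊩ d₂ }
  ⊢⇒⊩ (¬R b d)           = logicalR c¬ ↭-refl b λ { r¬ → ⊢⇒⊩ d }
  ⊢⇒⊩ (¬L a d)           = logicalL c¬ a ↭-refl λ { l¬ → ⊢⇒⊩ d }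
  ⊢⇒⊩ (□K σ ω a b d)     = □K σ ω a b (⊢⇒⊩ d)
  ⊢⇒⊩ (□D ≡KD σ ω a b d) = □D ≡KD σ ω a b (⊢⇒⊩ d)
  ⊢⇒⊩ (□T ≡KT a d)       = □T ≡KT a ↭-refl (⊢⇒⊩ d)

  ⊩⇒⊢ : Γ ⊩ Δ → Γ ↭ Γ′ → Δ ↭ Δ′ → L ⊢ Γ′ ⇒ Δ′
  ⊩⇒⊢ (init p a b) g h = init p (↭-sym-trans g a) (↭-sym-trans h b)
  ⊩⇒⊢ (⊥L a)       g h = ⊥L (↭-sym-trans g a)
  ⊩⇒⊢ (logicalR c∧ a b f) g h =
    ∧R (↭-sym-trans h b) (⊩⇒⊢ (f r∧₁) (↭-sym-trans a g) ↭-refl)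
                         (⊩⇒⊢ (f r∧₂) (↭-sym-trans a g) ↭-refl)
  ⊩⇒⊢ (logicalR c∨ a b f) g h =
    ∨R (↭-sym-trans h b) (⊩⇒⊢ (f r∨) (↭-sym-trans a g) ↭-refl)
  ⊩⇒⊢ (logicalR c⇒ a b f) g h =
    ⇒R (↭-sym-trans h b) (⊩⇒⊢ (f r⇒) (↭-prep _ (↭-sym-trans a g)) ↭-refl)
  ⊩⇒⊢ (logicalR c¬ a b f) g h =
    ¬R (↭-sym-trans h b) (⊩⇒⊢ (f r¬) (↭-prep _ (↭-sym-trans a g)) ↭-refl)
  ⊩⇒⊢ (logicalL c∧ a b f) g h =
    ∧L (↭-sym-trans g a) (⊩⇒⊢ (f l∧) ↭-refl (↭-sym-trans b h))
  ⊩⇒⊢ (logicalL c∨ a b f) g h =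
    ∨L (↭-sym-trans g a) (⊩⇒⊢ (f l∨₁) ↭-refl (↭-sym-trans b h))
                         (⊩⇒⊢ (f l∨₂) ↭-refl (↭-sym-trans b h))
  ⊩⇒⊢ (logicalL c⇒ a b f) g h =
    ⇒L (↭-sym-trans g a) (⊩⇒⊢ (f l⇒₁) ↭-refl (↭-prep _ (↭-sym-trans b h)))
                         (⊩⇒⊢ (f l⇒₂) ↭-refl (↭-sym-trans b h))
  ⊩⇒⊢ (logicalL c¬ a b f) g h =
    ¬L (↭-sym-trans g a) (⊩⇒⊢ (f l¬) ↭-refl (↭-prep _ (↭-sym-trans b h)))
  ⊩⇒⊢ (□K σ ω a b d) g h =
    □K σ ω (↭-sym-trans g a) (↭-sym-trans h b) (⊩⇒⊢ d ↭-refl ↭-refl)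
  ⊩⇒⊢ (□D ≡KD σ ω a b d) g h =
    □D ≡KD σ ω (↭-sym-trans g a) (↭-sym-trans h b) (⊩⇒⊢ d ↭-refl ↭-refl)
  ⊩⇒⊢ (□T ≡KT a b d) g h =
    □T ≡KT (↭-sym-trans g a) (⊩⇒⊢ d ↭-refl (↭-sym-trans b h))

  compound-¬Ω : Compound F → ¬ OmegaOK F
  compound-¬Ω () (ω-var _)
  compound-¬Ω () ω-⊥
  compound-¬Ω () (ω-□ _ _)

  SigmaOK⇒OmegaOK : SigmaOK i F → OmegaOK F
  SigmaOK⇒OmegaOK (σ-var p)   = ω-var p
  SigmaOK⇒OmegaOK σ-⊥         = ω-⊥
  SigmaOK⇒OmegaOK (σ-□ j B _) = ω-□ j B

  ¬SigmaOK-□ : ¬ SigmaOK i (□ i A)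
  ¬SigmaOK-□ (σ-□ _ _ i≢i) = i≢i refl

  ∈-Σ□⁻ : F ∈ Σ ++ □* i Γ → F ∈ Σ ⊎ ∃ λ C → C ∈ Γ × F ≡ □ i C
  ∈-Σ□⁻ {Σ = Σ} m with ∈-++⁻ Σ m
  ... | inj₁ F∈Σ  = inj₁ F∈Σ
  ... | inj₂ F∈□Γ = inj₂ (∈-map⁻ _ F∈□Γ)

  compound∉Σ□ : All (SigmaOK i) Σ → Compound F → F ∉ Σ ++ □* i Γ
  compound∉Σ□ σ c m with ∈-Σ□⁻ m
  ... | inj₁ F∈Σ            = compound-¬Ω c (SigmaOK⇒OmegaOK (All.lookup σ F∈Σ))
  ... | inj₂ (_ , _ , refl) = compound-¬Ω c (ω-□ _ _)

  remove-from-Σ : All (SigmaOK i) Σ → F ∷ Π ↭ Σ ++ □* i Γ → F ∈ Σ →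
                  ∃ λ Σ′ → All (SigmaOK i) Σ′ × Π ↭ Σ′ ++ □* i Γ
  remove-from-Σ {i = i} {Γ = Γ} σ p F∈Σ =
    let Σ′ , Σ↭FΣ′ = ∈-∃↭ F∈Σ
    in  Σ′ , tail (All-resp-↭ Σ↭FΣ′ σ) , drop-∷ (↭-trans p (++⁺ʳ (□* i Γ) Σ↭FΣ′))

  weakenʳ-Ω : OmegaOK F → Γ ⊩ Δ → Γ ⊩ F ∷ Δ
  weakenʳ-Ω ω (init p a b)        = init p a (++⁺ˡ-shift [ _ ] b)
  weakenʳ-Ω ω (⊥L a)              = ⊥L a
  weakenʳ-Ω ω (logicalR c a b f)  = logicalR c a (++⁺ˡ-shift [ _ ] b) λ {_} {Y} r →
    exchange (weakenʳ-Ω ω (f r)) ↭-refl (↭-sym (shift _ Y _))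
  weakenʳ-Ω ω (logicalL c a b f)  = logicalL c a (↭-prep _ b) λ {_} {Y} r →
    exchange (weakenʳ-Ω ω (f r)) ↭-refl (↭-sym (shift _ Y _))
  weakenʳ-Ω ω (□K σ ω′ a b d)     = □K σ (ω ∷ ω′) a (++⁺ˡ-shift [ _ ] b) d
  weakenʳ-Ω ω (□D ≡KD σ ω′ a b d) = □D ≡KD σ (ω ∷ ω′) a (↭-prep _ b) d
  weakenʳ-Ω ω (□T ≡KT a b d)      = □T ≡KT a (↭-prep _ b) (weakenʳ-Ω ω d)

  -- Weakening by a compound formula is its own logical rule applied to
  -- weakenings by the components, so only Ω-formulas need induction on the
  -- derivation.
  weakenˡ   : ∀ F → Γ ⊩ Δ → F ∷ Γ ⊩ Δ
  weakenʳ   : ∀ F → Γ ⊩ Δ → Γ ⊩ F ∷ Δ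
  weakenˡ-Ω : OmegaOK F → Γ ⊩ Δ → F ∷ Γ ⊩ Δ

  weakenˡ (var p)  d = weakenˡ-Ω (ω-var p) d
  weakenˡ ⊥'       d = weakenˡ-Ω ω-⊥ d
  weakenˡ (□ i C)  d = weakenˡ-Ω (ω-□ i C) d
  weakenˡ (A ∧' B) d = logicalL c∧ ↭-refl ↭-refl λ { l∧ → weakenˡ A (weakenˡ B d) }
  weakenˡ (A ∨' B) d = logicalL c∨ ↭-refl ↭-refl
                         λ { l∨₁ → weakenˡ A d ; l∨₂ → weakenˡ B d }
  weakenˡ (A ⇒' B) d = logicalL c⇒ ↭-refl ↭-refl
                         λ { l⇒₁ → weakenʳ A d ; l⇒₂ → weakenˡ B d }
  weakenˡ (¬' A)   d = logicalL c¬ ↭-refl ↭-refl λ { l¬ → weakenʳ A d }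

  weakenʳ (var p)  d = weakenʳ-Ω (ω-var p) d
  weakenʳ ⊥'       d = weakenʳ-Ω ω-⊥ d
  weakenʳ (□ i C)  d = weakenʳ-Ω (ω-□ i C) d
  weakenʳ (A ∧' B) d = logicalR c∧ ↭-refl ↭-refl
                         λ { r∧₁ → weakenʳ A d ; r∧₂ → weakenʳ B d }
  weakenʳ (A ∨' B) d = logicalR c∨ ↭-refl ↭-refl λ { r∨ → weakenʳ A (weakenʳ B d) }
  weakenʳ (A ⇒' B) d = logicalR c⇒ ↭-refl ↭-refl λ { r⇒ → weakenˡ A (weakenʳ B d) }
  weakenʳ (¬' A)   d = logicalR c¬ ↭-refl ↭-refl λ { r¬ → weakenˡ A d }

  weakenˡ-Ω ω (init p a b)       = init p (++⁺ˡ-shift [ _ ] a) b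
  weakenˡ-Ω ω (⊥L a)             = ⊥L (++⁺ˡ-shift [ _ ] a)
  weakenˡ-Ω ω (logicalR c a b f) = logicalR c (↭-prep _ a) b λ {X} r →
    exchange (weakenˡ-Ω ω (f r)) (↭-sym (shift _ X _)) ↭-refl
  weakenˡ-Ω ω (logicalL c a b f) = logicalL c (++⁺ˡ-shift [ _ ] a) b λ {X} r →
    exchange (weakenˡ-Ω ω (f r)) (↭-sym (shift _ X _)) ↭-refl
  -- A formula □ᵢC may not be a side formula of a □K or □D inference for
  -- agent i; it is added to the boxed formulas instead, and C to the premise.
  weakenˡ-Ω (ω-var p) (□K σ ω a b d) = □K (σ-var p ∷ σ) ω (↭-prep _ a) b d
  weakenˡ-Ω ω-⊥       (□K σ ω a b d) = □K (σ-⊥ ∷ σ) ω (↭-prep _ a) b d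
  weakenˡ-Ω (ω-□ j C) (□K {i = i} {Σ = Σ} σ ω a b d) with j ≟ i
  ... | yes refl = □K σ ω (↭-trans (↭-prep _ a) (↭-sym (shift _ Σ _))) b (weakenˡ C d)
  ... | no j≢i   = □K (σ-□ j C j≢i ∷ σ) ω (↭-prep _ a) b d
  weakenˡ-Ω (ω-var p) (□D ≡KD σ ω a b d) = □D ≡KD (σ-var p ∷ σ) ω (↭-prep _ a) b d
  weakenˡ-Ω ω-⊥       (□D ≡KD σ ω a b d) = □D ≡KD (σ-⊥ ∷ σ) ω (↭-prep _ a) b d
  weakenˡ-Ω (ω-□ j C) (□D {i = i} {Σ = Σ} ≡KD σ ω a b d) with j ≟ i
  ... | yes refl = □D ≡KD σ ω (↭-trans (↭-prep _ a) (↭-sym (shift _ Σ _))) b (weakenˡ C d)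
  ... | no j≢i   = □D ≡KD (σ-□ j C j≢i ∷ σ) ω (↭-prep _ a) b d
  weakenˡ-Ω {F = F} ω (□T {i = i} {A = A} {Γ = Γ} ≡KT a b d) =
    □T ≡KT (++⁺ˡ-shift [ _ ] a) b (exchange (weakenˡ-Ω ω d) rearrange ↭-refl)
    where
      rearrange : F ∷ □ i A ∷ A ∷ Γ ↭ □ i A ∷ A ∷ F ∷ Γ
      rearrange = ↭-trans (↭-swap F _ ↭-refl) (↭-prep _ (↭-swap F A ↭-refl))

  weakenˡ* : ∀ X → Γ ⊩ Δ → X ++ Γ ⊩ Δ
  weakenˡ* []      d = d
  weakenˡ* (F ∷ X) d = weakenˡ F (weakenˡ* X d)

  weakenʳ* : ∀ Y → Γ ⊩ Δ → Γ ⊩ Y ++ Δ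
  weakenʳ* []      d = d
  weakenʳ* (F ∷ Y) d = weakenʳ F (weakenʳ* Y d)

  weaken : ∀ X Y → Γ ⊩ Δ → Γ ++ X ⊩ Δ ++ Y
  weaken {Γ = Γ} {Δ = Δ} X Y d =
    exchange (weakenˡ* X (weakenʳ* Y d)) (++-comm X Γ) (++-comm Y Δ)

  invertʳ : ∀ {X Y} → Γ ⊩ Δ₀ → Δ₀ ↭ F ∷ Δ → Compound F → RightPremise F X Y →
            X ++ Γ ⊩ Y ++ Δ
  invertʳ {X = X} {Y} (init p a b) e c r with ↭-∷-inv (↭-sym-trans b e)
  ... | inj₁ (refl , _)  = ⊥-elim (compound-¬Ω c (ω-var p))
  ... | inj₂ (_ , q , _) = init p (++⁺ˡ-shift X a) (++⁺ˡ-shift Y q)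
  invertʳ {X = X} (⊥L a) e c r = ⊥L (++⁺ˡ-shift X a)
  invertʳ {X = X} {Y} (logicalR c′ a b f) e c r with ↭-∷-inv (↭-sym-trans b e)
  ... | inj₁ (refl , q)    = exchange (f r) (++⁺ˡ X (↭-sym a)) (++⁺ˡ Y q)
  ... | inj₂ (_ , q₁ , q₂) =
    logicalR c′ (++⁺ˡ X a) (++⁺ˡ-shift Y q₁) λ {X′} {Y′} r′ →
      exchange (invertʳ (f r′) (++⁺ˡ-shift Y′ q₂) c r) (shifts X X′) (shifts Y Y′)
  invertʳ {X = X} {Y} (logicalL c′ a b f) e c r =
    logicalL c′ (++⁺ˡ-shift X a) ↭-refl λ {X′} {Y′} l′ →
      exchange (invertʳ (f l′) (++⁺ˡ-shift Y′ (↭-sym-trans b e)) c r) (shifts X X′) (shifts Y Y′)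
  invertʳ (□K σ ω a b d) e c r with ↭-∷-inv (↭-sym-trans b e)
  ... | inj₁ (refl , _)  = ⊥-elim (compound-¬Ω c (ω-□ _ _))
  ... | inj₂ (_ , _ , q) = ⊥-elim (compound-¬Ω c (head (All-resp-↭ q ω)))
  invertʳ (□D ≡KD σ ω a b d) e c r =
    ⊥-elim (compound-¬Ω c (head (All-resp-↭ (↭-sym-trans b e) ω)))
  invertʳ {X = X} (□T ≡KT a b d) e c r =
    □T ≡KT (++⁺ˡ-shift X a) ↭-refl
      (exchange (invertʳ d (↭-sym-trans b e) c r) (shifts X (_ ∷ _ ∷ [])) ↭-refl)

  invertˡ : ∀ {X Y} → Γ₀ ⊩ Δ → Γ₀ ↭ F ∷ Γ → Compound F → LeftPremise F X Y →
            X ++ Γ ⊩ Y ++ Δ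
  invertˡ {X = X} {Y} (init p a b) e c l with ↭-∷-inv (↭-sym-trans a e)
  ... | inj₁ (refl , _)  = ⊥-elim (compound-¬Ω c (ω-var p))
  ... | inj₂ (_ , q , _) = init p (++⁺ˡ-shift X q) (++⁺ˡ-shift Y b)
  invertˡ {X = X} (⊥L a) e c l with ↭-∷-inv (↭-sym-trans a e)
  ... | inj₁ (refl , _)  = ⊥-elim (compound-¬Ω c ω-⊥)
  ... | inj₂ (_ , q , _) = ⊥L (++⁺ˡ-shift X q)
  invertˡ {X = X} {Y} (logicalR c′ a b f) e c l =
    logicalR c′ ↭-refl (++⁺ˡ-shift Y b) λ {X′} {Y′} r′ →
      exchange (invertˡ (f r′) (++⁺ˡ-shift X′ (↭-sym-trans a e)) c l) (shifts X X′) (shifts Y Y′)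
  invertˡ {X = X} {Y} (logicalL c′ a b f) e c l with ↭-∷-inv (↭-sym-trans a e)
  ... | inj₁ (refl , q)    = exchange (f l) (++⁺ˡ X q) (++⁺ˡ Y (↭-sym b))
  ... | inj₂ (_ , q₁ , q₂) =
    logicalL c′ (++⁺ˡ-shift X q₁) (++⁺ˡ Y b) λ {X′} {Y′} l′ →
      exchange (invertˡ (f l′) (++⁺ˡ-shift X′ q₂) c l) (shifts X X′) (shifts Y Y′)
  invertˡ (□K σ ω a b d)     e c l = ⊥-elim (compound∉Σ□ σ c (∈-resp-↭ a (↭∷⇒∈ e)))
  invertˡ (□D ≡KD σ ω a b d) e c l = ⊥-elim (compound∉Σ□ σ c (∈-resp-↭ a (↭∷⇒∈ e)))
  invertˡ {X = X} {Y} (□T {A = A} ≡KT a b d) e c l with ↭-∷-inv (↭-sym-trans a e)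
  ... | inj₁ (refl , _)    = ⊥-elim (compound-¬Ω c (ω-□ _ _))
  ... | inj₂ (_ , q₁ , q₂) = □T ≡KT (++⁺ˡ-shift X q₁) (++⁺ˡ Y b)
    (exchange (invertˡ d (++⁺ˡ-shift (_ ∷ A ∷ []) q₂) c l) (shifts X (_ ∷ A ∷ [])) ↭-refl)

  contract-var : Γ₀ ⊩ Δ → Γ₀ ↭ var p ∷ var p ∷ Γ → var p ∷ Γ ⊩ Δ
  contract-var (init q a b) e = init q (proj₂ (↭-dedup-∷ a e)) b
  contract-var (⊥L a)       e = ⊥L (proj₂ (↭-dedup-∷ a e))
  contract-var {p = p} (logicalR c a b f) e = logicalR c ↭-refl b λ {X} r →
    exchange (contract-var (f r) (++⁺ˡ-shifts X (var p ∷ var p ∷ []) (↭-sym-trans a e)))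
             (↭-sym (shift _ X _)) ↭-refl
  contract-var {p = p} (logicalL c a b f) e =
    let ws , Γ↭Fws , Γ′↭ppws =
          ↭-∷-inv₂-≢ (↭-sym-trans a e) λ { refl → compound-¬Ω c (ω-var p) }
    in  logicalL c (++⁺ˡ-shift [ _ ] Γ↭Fws) b λ {X} l →
          exchange (contract-var (f l) (++⁺ˡ-shifts X (var p ∷ var p ∷ []) Γ′↭ppws))
                   (↭-sym (shift _ X _)) ↭-refl
  contract-var (□K σ ω a b d) e with ∈-Σ□⁻ (∈-resp-↭ a (↭∷⇒∈ e))
  ... | inj₁ p∈Σ =
    let _ , σ′ , a′ = remove-from-Σ σ (↭-sym-trans e a) p∈Σ in □K σ′ ω a′ b d
  ... | inj₂ (_ , _ , ())
  contract-var (□D ≡KD σ ω a b d) e with ∈-Σ□⁻ (∈-resp-↭ a (↭∷⇒∈ e))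
  ... | inj₁ p∈Σ =
    let _ , σ′ , a′ = remove-from-Σ σ (↭-sym-trans e a) p∈Σ in □D ≡KD σ′ ω a′ b d
  ... | inj₂ (_ , _ , ())
  contract-var {p = p} (□T {A = A} ≡KT a b d) e =
    let ws , Γ↭□Aws , Γ′↭ppws = ↭-∷-inv₂-≢ (↭-sym-trans a e) λ ()
    in  □T ≡KT (++⁺ˡ-shift [ _ ] Γ↭□Aws) b
          (exchange (contract-var d (++⁺ˡ-shifts (_ ∷ A ∷ []) (var p ∷ var p ∷ []) Γ′↭ppws))
                    (↭-trans (↭-swap _ _ ↭-refl) (↭-prep _ (↭-swap _ _ ↭-refl))) ↭-refl)

  CutAdmissible : Fm n → Set
  CutAdmissible A = ∀ {Γ Δ} → Γ ⊩ A ∷ Δ → A ∷ Γ ⊩ Δ → Γ ⊩ Δ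

  □T* : L ≡ KTn → ∀ Γ₁ → Π ↭ □* i Γ₁ ++ R → Γ₁ ++ Π ⊩ Δ → Π ⊩ Δ
  □T* ≡KT []       s d = d
  □T* {Π = Π} {i = i} {R = R} ≡KT (C ∷ Γ₁) s d =
    □T ≡KT s ↭-refl
      (exchange (□T* ≡KT Γ₁ s′ (exchange d (↭-sym (shift C Γ₁ Π)) ↭-refl)) rearrange ↭-refl)
    where
      s′ : C ∷ Π ↭ □* i Γ₁ ++ C ∷ □ i C ∷ R
      s′ = ↭-trans (↭-prep C s) (shifts (C ∷ □ i C ∷ []) (□* i Γ₁))
      rearrange : C ∷ Π ↭ □ i C ∷ C ∷ □* i Γ₁ ++ R
      rearrange = ↭-trans (↭-prep C s) (↭-swap C (□ i C) ↭-refl)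

  unbox : All (SigmaOK i) Σ → ∀ Γ₁ → Σ ++ □* i Γ ↭ □* i Γ₁ ++ R →
          ∃ λ R′ → Γ ↭ Γ₁ ++ R′
  unbox {Γ = Γ} σ [] _ = Γ , ↭-refl
  unbox {i = i} {Σ = Σ} σ (C ∷ Γ₁) p with ∈-Σ□⁻ (↭∷⇒∈ p)
  ... | inj₁ □C∈Σ = ⊥-elim (¬SigmaOK-□ (All.lookup σ □C∈Σ))
  ... | inj₂ (_ , C∈Γ , refl) =
    let Γ′ , Γ↭CΓ′   = ∈-∃↭ C∈Γ
        R′ , Γ′↭Γ₁R′ =
          unbox σ Γ₁ (drop-∷ (↭-sym-trans (++⁺ˡ-shift Σ (map⁺ (□ i) Γ↭CΓ′)) p))
    in  R′ , ↭-trans Γ↭CΓ′ (↭-prep C Γ′↭Γ₁R′)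

  unbox-principal : All (SigmaOK i) Σ → □ i B ∷ Π ↭ Σ ++ □* i Γ → Π ↭ □* i Γ₁ ++ R →
                    ∃ λ R′ → Γ ↭ B ∷ Γ₁ ++ R′ × Π ↭ Σ ++ □* i (Γ₁ ++ R′)
  unbox-principal {i = i} {Σ = Σ} {Γ₁ = Γ₁} σ e s =
    let R′ , Γ↭BΓ₁R′ = unbox σ (_ ∷ Γ₁) (↭-sym-trans e (↭-prep _ s))
    in  R′ , Γ↭BΓ₁R′ , drop-∷ (↭-trans e (++⁺ˡ-shift Σ (map⁺ (□ i) Γ↭BΓ₁R′)))

  □D-or-weaken : L ≡ KDn → All (SigmaOK i) Σ → All OmegaOK Ω → Θ ↭ Ω →
                 ∀ Γ → Π ↭ Σ ++ □* i Γ → Γ ⊩ [] → Π ⊩ Θ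
  □D-or-weaken {Θ = Θ} {Π = Π} _ _ _ _ [] _ d = weaken Π Θ d
  □D-or-weaken ≡KD σ ω b (_ ∷ _) a d = □D ≡KD σ ω a b d

  cut-□ : CutAdmissible B → Γ₁ ⊩ [ B ] → Π ↭ □* i Γ₁ ++ R →
          Π₀ ⊩ Θ → Π₀ ↭ □ i B ∷ Π → Π ⊩ Θ
  cut-□ cutB ⊢B s (init p a b) e with ↭-∷-inv (↭-sym-trans a e)
  ... | inj₁ (() , _)
  ... | inj₂ (_ , q , _) = init p q b
  cut-□ cutB ⊢B s (⊥L a) e with ↭-∷-inv (↭-sym-trans a e)
  ... | inj₁ (() , _)
  ... | inj₂ (_ , q , _) = ⊥L q
  cut-□ {Γ₁ = Γ₁} {i = i} cutB ⊢B s (logicalR c a b f) e = logicalR c ↭-refl b λ {X} r →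
    cut-□ cutB ⊢B (++⁺ˡ-shifts X (□* i Γ₁) s) (f r) (++⁺ˡ-shift X (↭-sym-trans a e))
  cut-□ {Γ₁ = Γ₁} {i = i} cutB ⊢B s (logicalL c a b f) e with ↭-∷-inv (↭-sym-trans a e)
  ... | inj₁ (refl , _)    = ⊥-elim (compound-¬Ω c (ω-□ _ _))
  ... | inj₂ (_ , q₁ , q₂) =
    let _ , s′ = drop-∷-∉ (↭-sym-trans q₁ s) (compound∉Σ□ {i = i} {Γ = Γ₁} [] c)
    in  logicalL c q₁ b λ {X} l →
          cut-□ cutB ⊢B (++⁺ˡ-shifts X (□* i Γ₁) s′) (f l) (++⁺ˡ-shift X q₂)
  cut-□ cutB ⊢B s (□K σ ω a b d) e with ∈-Σ□⁻ (∈-resp-↭ a (↭∷⇒∈ e))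
  ... | inj₁ □B∈Σ =
    let _ , σ′ , a′ = remove-from-Σ σ (↭-sym-trans e a) □B∈Σ
    in  □K σ′ ω a′ b d
  ... | inj₂ (_ , _ , refl) =
    let R′ , q , a′ = unbox-principal σ (↭-sym-trans e a) s
    in  □K σ ω a′ b (cutB (weaken R′ [ _ ] ⊢B) (exchange d q ↭-refl))
  cut-□ {Γ₁ = Γ₁} cutB ⊢B s (□D ≡KD σ ω a b d) e
    with ∈-Σ□⁻ (∈-resp-↭ a (↭∷⇒∈ e))
  ... | inj₁ □B∈Σ =
    let _ , σ′ , a′ = remove-from-Σ σ (↭-sym-trans e a) □B∈Σ
    in  □D ≡KD σ′ ω a′ b d
  ... | inj₂ (_ , _ , refl) =
    let R′ , q , a′ = unbox-principal σ (↭-sym-trans e a) s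
    in  □D-or-weaken ≡KD σ ω b (Γ₁ ++ R′) a′ (cutB (weaken R′ [] ⊢B) (exchange d q ↭-refl))
  cut-□ {B = B} {Γ₁ = Γ₁} {Π = Π} {i = i} {R = R} cutB ⊢B s
        (□T {i = j} {A = C} {Δ = Θ′} ≡KT a b d) e
    with ↭-∷-inv (↭-sym-trans a e)
  ... | inj₁ (refl , q) =
    exchange (cutB (□T* ≡KT Γ₁ s (weaken Π Θ′ ⊢B))
                   (cut-□ cutB ⊢B (++⁺ˡ-shifts [ B ] (□* i Γ₁) s) d (↭-prep _ (↭-prep B q))))
             ↭-refl (↭-sym b)
  ... | inj₂ (zs , q₁ , q₂) =
    □T ≡KT q₁ b (cut-□ cutB ⊢B s′ d (++⁺ˡ-shift (_ ∷ C ∷ []) q₂))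
    where
      s′ : □ j C ∷ C ∷ zs ↭ □* i Γ₁ ++ C ∷ R
      s′ = ↭-trans (↭-swap _ C ↭-refl)
                   (↭-trans (↭-prep C (↭-sym q₁)) (++⁺ˡ-shifts [ C ] (□* i Γ₁) s))

  cut-Ω : OmegaOK A → (∀ {i C} → A ≡ □ i C → CutAdmissible C) →
          Γ ⊩ Δ₀ → Δ₀ ↭ A ∷ Δ → A ∷ Γ ⊩ Δ → Γ ⊩ Δ
  cut-Ω ω cut-body (init p a b) e A⊢ with ↭-∷-inv (↭-sym-trans b e)
  ... | inj₁ (refl , _)  = exchange (contract-var A⊢ (↭-prep _ a)) (↭-sym a) ↭-refl
  ... | inj₂ (_ , q , _) = init p a q
  cut-Ω ω cut-body (⊥L a) e A⊢ = ⊥L a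
  cut-Ω ω cut-body (logicalR c a b f) e A⊢ with ↭-∷-inv (↭-sym-trans b e)
  ... | inj₁ (refl , _)    = ⊥-elim (compound-¬Ω c ω)
  ... | inj₂ (_ , q₁ , q₂) = logicalR c a q₁ λ {X} {Y} r →
    cut-Ω ω cut-body (f r) (++⁺ˡ-shift Y q₂)
      (exchange (invertʳ A⊢ q₁ c r) (++⁺ˡ-shift X (↭-prep _ a)) ↭-refl)
  cut-Ω ω cut-body (logicalL c a b f) e A⊢ = logicalL c a ↭-refl λ {X} {Y} l →
    cut-Ω ω cut-body (f l) (++⁺ˡ-shift Y (↭-sym-trans b e))
      (exchange (invertˡ A⊢ (++⁺ˡ-shift [ _ ] a) c l) (shift _ X _) ↭-refl)
  cut-Ω ω cut-body (□K {Σ = Σ} σ ω′ a b d) e A⊢ with ↭-∷-inv (↭-sym-trans b e)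
  ... | inj₁ (refl , _)    = cut-□ (cut-body refl) d (↭-trans a (++-comm Σ _)) A⊢ ↭-refl
  ... | inj₂ (_ , q₁ , q₂) = □K σ (tail (All-resp-↭ q₂ ω′)) a q₁ d
  cut-Ω ω cut-body (□D ≡KD σ ω′ a b d) e A⊢ =
    □D ≡KD σ (tail (All-resp-↭ (↭-sym-trans b e) ω′)) a ↭-refl d
  cut-Ω {A = A} {Γ = Γ} ω cut-body (□T {i = i} {A = C} {Γ = Γ′} ≡KT a b d) e A⊢ =
    □T ≡KT a ↭-refl
      (cut-Ω ω cut-body d (↭-sym-trans b e) (exchange (weakenˡ C A⊢) rearrange ↭-refl))
    where
      rearrange : C ∷ A ∷ Γ ↭ A ∷ □ i C ∷ C ∷ Γ′
      rearrange = ↭-trans (↭-prep C (↭-prep A a))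
                          (↭-trans (↭-swap C A ↭-refl) (↭-prep A (↭-swap C _ ↭-refl)))

  cut : ∀ A → CutAdmissible A
  cut (var p) d e = cut-Ω (ω-var p) (λ ()) d ↭-refl e
  cut ⊥'      d e = cut-Ω ω-⊥ (λ ()) d ↭-refl e
  cut (□ i B) d e = cut-Ω (ω-□ i B) (λ { refl → cut B }) d ↭-refl e
  cut (A ∧' B) d e =
    cut A (invertʳ d ↭-refl c∧ r∧₁)
          (cut B (weakenˡ A (invertʳ d ↭-refl c∧ r∧₂))
                 (exchange (invertˡ e ↭-refl c∧ l∧) (↭-swap A B ↭-refl) ↭-refl))
  cut (A ∨' B) d e =
    cut A (cut B (exchange (invertʳ d ↭-refl c∨ r∨) ↭-refl (↭-swap A B ↭-refl))
                 (weakenʳ A (invertˡ e ↭-refl c∨ l∨₂)))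
          (invertˡ e ↭-refl c∨ l∨₁)
  cut (A ⇒' B) d e =
    cut A (invertˡ e ↭-refl c⇒ l⇒₁)
          (cut B (invertʳ d ↭-refl c⇒ r⇒)
                 (exchange (weakenˡ A (invertˡ e ↭-refl c⇒ l⇒₂)) (↭-swap A B ↭-refl) ↭-refl))
  cut (¬' A) d e = cut A (invertˡ e ↭-refl c¬ l¬) (invertʳ d ↭-refl c¬ r¬)

proposition3p11 : (n : ℕ) (L : Logic) (Γ Γ' Δ Δ' : List (Fm n)) (A : Fm n) →
    L ⊢ Γ ⇒ Δ ++ (A ∷ []) → L ⊢ A ∷ Γ' ⇒ Δ' → L ⊢ Γ ++ Γ' ⇒ Δ ++ Δ'
proposition3p11 n L Γ Γ' Δ Δ' A d e = ⊩⇒⊢ (cut A left right) ↭-refl ↭-refl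
  where
    open CutAdmissibility {n} L

    left : Γ ++ Γ' ⊩ A ∷ Δ ++ Δ'
    left = exchange (weaken Γ' Δ' (⊢⇒⊩ d)) ↭-refl
                    (↭-trans (++-assoc Δ [ A ] Δ') (shift A Δ Δ'))

    right : A ∷ Γ ++ Γ' ⊩ Δ ++ Δ'
    right = exchange (weakenˡ* Γ (weakenʳ* Δ (⊢⇒⊩ e))) (shift A Γ Γ') ↭-refl
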